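{- Let $R\in\{D,P\}$ and let $r,s,t$ be $\lambda^{\Box\rightarrow\wedge\vee\bot}$-terms with $r>_\bot s>_R t$. Then there is a $\lambda^{\Box\rightarrow\wedge\vee\bot}$-term $k$ such that $r\overset{+}{>}_R k\gg_\bot t$, where $\overset{+}{>}_R$ is the transitive closure of $>_R$ and $\gg_\bot$ the reflexive–transitive closure of $>_\bot$.
   Context: Terms of $\lambda^{\Box\rightarrow\wedge\vee\bot}$: $x\mid \lambda x.t\mid ts\mid \langle t,s\rangle\mid \pi_1 t\mid \pi_2 t\mid \mathsf{in}_1 t\mid \mathsf{in}_2 t\mid \mathsf{C}_{x,y}(t,t_1,t_2)\mid \mathsf{E}(t)\mid \mathsf{B}_{x_1,\dots,x_n}(t_1,\dots,t_n)\,\mathsf{in}\,s$ ($\mathsf{C}$ binds $x$ in $t_1$, $y$ in $t_2$; $\mathsf{B}$ binds $x_1,\dots,x_n$ in $s$). All reductions are one-step and closed under term contexts. Detours $>_D$: $(\lambda x.t)s> t[x:=s]$; $\pi_i\langle t_1,t_2\rangle> t_i$; $\mathsf{C}_{x_1,x_2}(\mathsf{in}_i t,t_1,t_2)> t_i[x_i:=t]$; $\mathsf{B}_{x_1,\dots,x_{i-1},x_i,x_{i+1},\dots,x_n}(t_1,\dots,t_{i-1},(\mathsf{B}_{\vec y}(\vec s)\,\mathsf{in}\,t_i),t_{i+1},\dots,t_n)\,\mathsf{in}\,r > \mathsf{B}_{x_1,\dots,x_{i-1},\vec y,x_{i+1},\dots,x_n}(t_1,\dots,t_{i-1},\vec s,t_{i+1},\dots,t_n)\,\mathsf{in}\,r[x_i:=t_i]$;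 $\mathsf{B}_x t\,\mathsf{in}\,x> t$. Permutations $>_P$: $\mathsf{C}_{x,y}(t,t_1,t_2)s>\mathsf{C}_{x,y}(t,t_1s,t_2s)$; $\pi_i\mathsf{C}_{x,y}(t,t_1,t_2)>\mathsf{C}_{x,y}(t,\pi_it_1,\pi_it_2)$; $\mathsf{C}_{u,v}(\mathsf{C}_{x,y}(t,t_1,t_2),s_1,s_2)>\mathsf{C}_{x,y}(t,\mathsf{C}_{u,v}(t_1,s_1,s_2),\mathsf{C}_{u,v}(t_2,s_1,s_2))$; $\mathsf{B}_{\vec x}(t_1,\dots,t_{i-1},\mathsf{C}_{x,y}(t,s_1,s_2),t_{i+1},\dots,t_n)\,\mathsf{in}\,s>\mathsf{C}_{x,y}(t,\mathsf{B}_{\vec x}(t_1,\dots,s_1,\dots,t_n)\,\mathsf{in}\,s,\ \mathsf{B}_{\vec x}(t_1,\dots,s_2,\dots,t_n)\,\mathsf{in}\,s)$; $\mathsf{E}(\mathsf{C}_{x,y}(t,t_1,t_2))>\mathsf{C}_{x,y}(t,\mathsf{E}(t_1),\mathsf{E}(t_2))$. $\bot$-conversions $>_\bot$: $\mathsf{E}(t)s>\mathsf{E}(t)$; $\pi_i\mathsf{E}(t)>\mathsf{E}(t)$; $\mathsf{C}_{x,y}(\mathsf{E}(t),t_1,t_2)>\mathsf{E}(t)$; $\mathsf{E}(\mathsf{E}(t))>\mathsf{E}(t)$; $\mathsf{B}_{x_1,\dots,x_n}(t_1,\dots,t_{i-1},\mathsf{E}(t_i),t_{i+1},\dots,t_n)\,\mathsf{in}\,s>\mathsf{E}(t_i)$.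 -}

module Defs where

open import Data.Nat using (ℕ; zero; suc; _+_)
open import Data.Fin using (Fin; zero; suc; _↑ˡ_; _↑ʳ_; splitAt)
open import Data.Sum using (_⊎_; inj₁; inj₂)
open import Data.Vec using (Vec; []; _∷_; _++_)
open import Data.Product using (∃; _×_)
open import Relation.Binary.Construct.Closure.Transitive using (TransClosure)
open import Relation.Binary.Construct.Closure.ReflexiveTransitive using (Star)

-- Tm n = terms with (at most) n free variables, Fin n.
--   lam t      : t ∈ Tm (suc n), index zero is the bound variable.
--   case t t₁ t₂ : C_{x,y}(t,t₁,t₂); in t₁ (resp. t₂) index zero is x (resp. y).
--   box k ts s : B_{x₁..x_k}(t₁..t_k) in s, with ts : Vec (Tm n) k and
--                s : Tm (k + n); in s the index p ↑ˡ n (p : Fin k) is the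
--                bound variable x_{p+1}, and k ↑ʳ q is the free variable q.

data Tm (n : ℕ) : Set where
  var  : Fin n → Tm n
  lam  : Tm (suc n) → Tm n
  app  : Tm n → Tm n → Tm n
  pair : Tm n → Tm n → Tm n
  pi1  : Tm n → Tm n
  pi2  : Tm n → Tm n
  in1  : Tm n → Tm n
  in2  : Tm n → Tm n
  case : Tm n → Tm (suc n) → Tm (suc n) → Tm n
  E    : Tm n → Tm n
  box  : (k : ℕ) → Vec (Tm n) k → Tm (k + n) → Tm n

liftR : ∀ {m m'} k → (Fin m → Fin m') → Fin (k + m) → Fin (k + m')
liftR {m} {m'} k ρ i with splitAt k i
... | inj₁ a = a ↑ˡ m'
... | inj₂ b = k ↑ʳ ρ b

mutual
  ren : ∀ {m m'} → (Fin m → Fin m') → Tm m → Tm m'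
  ren ρ (var x)        = var (ρ x)
  ren ρ (lam t)        = lam (ren (liftR 1 ρ) t)
  ren ρ (app t s)      = app (ren ρ t) (ren ρ s)
  ren ρ (pair t s)     = pair (ren ρ t) (ren ρ s)
  ren ρ (pi1 t)        = pi1 (ren ρ t)
  ren ρ (pi2 t)        = pi2 (ren ρ t)
  ren ρ (in1 t)        = in1 (ren ρ t)
  ren ρ (in2 t)        = in2 (ren ρ t)
  ren ρ (case t t₁ t₂) = case (ren ρ t) (ren (liftR 1 ρ) t₁) (ren (liftR 1 ρ) t₂)
  ren ρ (E t)          = E (ren ρ t)
  ren ρ (box k ts s)   = box k (renV ρ ts) (ren (liftR k ρ) s)

  renV : ∀ {m m' k} → (Fin m → Fin m') → Vec (Tm m) k → Vec (Tm m') k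
  renV ρ []       = []
  renV ρ (t ∷ ts) = ren ρ t ∷ renV ρ ts

wk : ∀ {m} → Tm m → Tm (suc m)
wk = ren suc

wkV : ∀ {m k} → Vec (Tm m) k → Vec (Tm (suc m)) k
wkV = renV suc

liftS : ∀ {m m'} k → (Fin m → Tm m') → Fin (k + m) → Tm (k + m')
liftS {m} {m'} k σ i with splitAt k i
... | inj₁ a = var (a ↑ˡ m')
... | inj₂ b = ren (k ↑ʳ_) (σ b)

mutual
  sub : ∀ {m m'} → (Fin m → Tm m') → Tm m → Tm m'
  sub σ (var x)        = σ x
  sub σ (lam t)        = lam (sub (liftS 1 σ) t)
  sub σ (app t s)      = app (sub σ t) (sub σ s)
  sub σ (pair t s)     = pair (sub σ t) (sub σ s)
  sub σ (pi1 t)        = pi1 (sub σ t)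
  sub σ (pi2 t)        = pi2 (sub σ t)
  sub σ (in1 t)        = in1 (sub σ t)
  sub σ (in2 t)        = in2 (sub σ t)
  sub σ (case t t₁ t₂) = case (sub σ t) (sub (liftS 1 σ) t₁) (sub (liftS 1 σ) t₂)
  sub σ (E t)          = E (sub σ t)
  sub σ (box k ts s)   = box k (subV σ ts) (sub (liftS k σ) s)

  subV : ∀ {m m' k} → (Fin m → Tm m') → Vec (Tm m) k → Vec (Tm m') k
  subV σ []       = []
  subV σ (t ∷ ts) = sub σ t ∷ subV σ ts

sub0 : ∀ {m} → Tm m → Fin (suc m) → Tm m
sub0 s zero    = s
sub0 s (suc x) = var x

_[0:=_] : ∀ {m} → Tm (suc m) → Tm m → Tm m
t [0:= s ] = sub (sub0 s) t

-- The substitution used by the B-detour: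
--   B_{x₁..x_{i}, x, x'₁..x'_j}(before, B_{ȳ}(ss) in u, after) in r
--     > B_{x₁..x_i, ȳ, x'₁..x'_j}(before, ss, after) in r[x := u]
-- r lives in scope (i + suc j) + m, u in scope k + m,
-- the result body in scope (i + (k + j)) + m.
renInner : ∀ {m} i k j → Fin (k + m) → Fin ((i + (k + j)) + m)
renInner {m} i k j q with splitAt k q
... | inj₁ d = (i ↑ʳ (d ↑ˡ j)) ↑ˡ m
... | inj₂ e = (i + (k + j)) ↑ʳ e

mergeσ : ∀ {m} i k j → Tm (k + m) → Fin ((i + suc j) + m) → Tm ((i + (k + j)) + m)
mergeσ {m} i k j u p with splitAt (i + suc j) p
... | inj₂ q = var ((i + (k + j)) ↑ʳ q)
... | inj₁ a with splitAt i a
...   | inj₁ b = var ((b ↑ˡ (k + j)) ↑ˡ m)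
...   | inj₂ zero = ren (renInner i k j) u
...   | inj₂ (suc c) = var ((i ↑ʳ (k ↑ʳ c)) ↑ˡ m)

TmRel : Set₁
TmRel = ∀ {n} → Tm n → Tm n → Set

data DetourR : TmRel where
  β     : ∀ {n} (t : Tm (suc n)) s → DetourR (app (lam t) s) (t [0:= s ])
  π₁β   : ∀ {n} (t₁ t₂ : Tm n) → DetourR (pi1 (pair t₁ t₂)) t₁
  π₂β   : ∀ {n} (t₁ t₂ : Tm n) → DetourR (pi2 (pair t₁ t₂)) t₂
  C₁β   : ∀ {n} (t : Tm n) t₁ t₂ → DetourR (case (in1 t) t₁ t₂) (t₁ [0:= t ])
  C₂β   : ∀ {n} (t : Tm n) t₁ t₂ → DetourR (case (in2 t) t₁ t₂) (t₂ [0:= t ])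
  Bβ    : ∀ {n} i k j (before : Vec (Tm n) i) (ss : Vec (Tm n) k) (u : Tm (k + n))
            (after : Vec (Tm n) j) (r : Tm ((i + suc j) + n)) →
          DetourR (box (i + suc j) (before ++ box k ss u ∷ after) r)
                  (box (i + (k + j)) (before ++ ss ++ after) (sub (mergeσ i k j u) r))
  Bη    : ∀ {n} (t : Tm n) → DetourR (box 1 (t ∷ []) (var zero)) t

data PermR : TmRel where
  appC  : ∀ {n} (t : Tm n) t₁ t₂ s →
          PermR (app (case t t₁ t₂) s) (case t (app t₁ (wk s)) (app t₂ (wk s)))
  pi1C  : ∀ {n} (t : Tm n) t₁ t₂ → PermR (pi1 (case t t₁ t₂)) (case t (pi1 t₁) (pi1 t₂))
  pi2C  : ∀ {n} (t : Tm n) t₁ t₂ → PermR (pi2 (case t t₁ t₂)) (case t (pi2 t₁) (pi2 t₂))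
  CC    : ∀ {n} (t : Tm n) t₁ t₂ s₁ s₂ →
          PermR (case (case t t₁ t₂) s₁ s₂)
                (case t (case t₁ (ren (liftR 1 suc) s₁) (ren (liftR 1 suc) s₂))
                        (case t₂ (ren (liftR 1 suc) s₁) (ren (liftR 1 suc) s₂)))
  BC    : ∀ {n} i j (before : Vec (Tm n) i) (t : Tm n) s₁ s₂ (after : Vec (Tm n) j)
            (s : Tm ((i + suc j) + n)) →
          PermR (box (i + suc j) (before ++ case t s₁ s₂ ∷ after) s)
                (case t (box (i + suc j) (wkV before ++ s₁ ∷ wkV after) (ren (liftR (i + suc j) suc) s))
                        (box (i + suc j) (wkV before ++ s₂ ∷ wkV after) (ren (liftR (i + suc j) suc) s)))
  EC    : ∀ {n} (t : Tm n) t₁ t₂ → PermR (E (case t t₁ t₂)) (case t (E t₁) (E t₂))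

data BotR : TmRel where
  appE  : ∀ {n} (t s : Tm n) → BotR (app (E t) s) (E t)
  pi1E  : ∀ {n} (t : Tm n) → BotR (pi1 (E t)) (E t)
  pi2E  : ∀ {n} (t : Tm n) → BotR (pi2 (E t)) (E t)
  CE    : ∀ {n} (t : Tm n) t₁ t₂ → BotR (case (E t) t₁ t₂) (E t)
  EE    : ∀ {n} (t : Tm n) → BotR (E (E t)) (E t)
  BE    : ∀ {n} i j (before : Vec (Tm n) i) (t : Tm n) (after : Vec (Tm n) j)
            (s : Tm ((i + suc j) + n)) →
          BotR (box (i + suc j) (before ++ E t ∷ after) s) (E t)

data Comp (R : TmRel) : TmRel where
  root  : ∀ {n} {t t' : Tm n} → R t t' → Comp R t t'
  lamC  : ∀ {n} {t t' : Tm (suc n)} → Comp R t t' → Comp R (lam t) (lam t')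
  appL  : ∀ {n} {t t' s : Tm n} → Comp R t t' → Comp R (app t s) (app t' s)
  appR  : ∀ {n} {t s s' : Tm n} → Comp R s s' → Comp R (app t s) (app t s')
  pairL : ∀ {n} {t t' s : Tm n} → Comp R t t' → Comp R (pair t s) (pair t' s)
  pairR : ∀ {n} {t s s' : Tm n} → Comp R s s' → Comp R (pair t s) (pair t s')
  pi1C  : ∀ {n} {t t' : Tm n} → Comp R t t' → Comp R (pi1 t) (pi1 t')
  pi2C  : ∀ {n} {t t' : Tm n} → Comp R t t' → Comp R (pi2 t) (pi2 t')
  in1C  : ∀ {n} {t t' : Tm n} → Comp R t t' → Comp R (in1 t) (in1 t')
  in2C  : ∀ {n} {t t' : Tm n} → Comp R t t' → Comp R (in2 t) (in2 t')
  caseC : ∀ {n} {t t' : Tm n} {t₁ t₂} → Comp R t t' → Comp R (case t t₁ t₂) (case t' t₁ t₂)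
  case1 : ∀ {n} {t : Tm n} {t₁ t₁' t₂} → Comp R t₁ t₁' → Comp R (case t t₁ t₂) (case t t₁' t₂)
  case2 : ∀ {n} {t : Tm n} {t₁ t₂ t₂'} → Comp R t₂ t₂' → Comp R (case t t₁ t₂) (case t t₁ t₂')
  EC    : ∀ {n} {t t' : Tm n} → Comp R t t' → Comp R (E t) (E t')
  boxArg : ∀ {n} i j {before : Vec (Tm n) i} {t t' : Tm n} {after : Vec (Tm n) j}
             {s : Tm ((i + suc j) + n)} → Comp R t t' →
           Comp R (box (i + suc j) (before ++ t ∷ after) s) (box (i + suc j) (before ++ t' ∷ after) s)
  boxBody : ∀ {n} k {ts : Vec (Tm n) k} {s s' : Tm (k + n)} → Comp R s s' →
           Comp R (box k ts s) (box k ts s')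

data RKind : Set where
  D P : RKind

_>D_ _>P_ _>⊥_ : TmRel
_>D_ = Comp DetourR
_>P_ = Comp PermR
_>⊥_ = Comp BotR

red : RKind → TmRel
red D = _>D_
red P = _>P_

_>⁺[_]_ : ∀ {n} → Tm n → RKind → Tm n → Set
r >⁺[ R ] k = TransClosure (red R) r k

_≫⊥_ : ∀ {n} → Tm n → Tm n → Set
k ≫⊥ t = Star _>⊥_ k t

-- Steps in disjoint positions commute, and a nested R-step is handled by the
-- induction hypothesis. Otherwise the R-redex contracted in s already occurs in r
-- with the ⊥-redex inside it, because a ⊥-conversion only produces a term E a and
-- the only redex E a can head is the permutation E (C …). So r contracts the same
-- redex, and the ⊥-step, possibly copied or erased by a substitution, follows as
-- ≫⊥. In the remaining case, E a at the root permuted into a case, r is an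
-- elimination around E (C …): it first permutes E and then the elimination into
-- the case, which is why two R-steps may be needed.
module Submission where

open import Defs
open import Data.Nat using (ℕ; suc; _+_)
open import Data.Fin using (Fin; zero; suc; _↑ʳ_; splitAt)
open import Data.Sum using (inj₁; inj₂)
open import Data.Vec using (Vec; []; _∷_; _++_)
open import Data.Product using (∃; _×_; _,_; proj₁)
open import Data.Empty using (⊥)
open import Relation.Binary.Construct.Closure.Transitive using (TransClosure; [_]; _∷_)
open import Relation.Binary.Construct.Closure.ReflexiveTransitive using (Star; ε; _◅_; _◅◅_; gmap; return)
open import Relation.Binary.PropositionalEquality using (_≡_; refl; cong)

data OneStep {A : Set} (Q : A → A → Set) : ∀ {k} → Vec A k → Vec A k → Set where
  here  : ∀ {k x y} {v : Vec A k} → Q x y → OneStep Q (x ∷ v) (y ∷ v)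
  there : ∀ {k x} {v v' : Vec A k} → OneStep Q v v' → OneStep Q (x ∷ v) (x ∷ v')

data Focused {A : Set} (Q : A → A → Set) : ∀ {k} → Vec A k → Vec A k → Set where
  focus : ∀ {i j} (b : Vec A i) {x y} (a : Vec A j) → Q x y → Focused Q (b ++ x ∷ a) (b ++ y ∷ a)

module _ {A : Set} {Q : A → A → Set} where

  OneStep⇒Focused : ∀ {k} {v v' : Vec A k} → OneStep Q v v' → Focused Q v v'
  OneStep⇒Focused (here {v = v} q) = focus [] v q
  OneStep⇒Focused (there {x = x} o) with OneStep⇒Focused o
  ... | focus b a q = focus (x ∷ b) a q

  OneStep-focus : ∀ {i j} (b : Vec A i) {x y} (a : Vec A j) → Q x y → OneStep Q (b ++ x ∷ a) (b ++ y ∷ a)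
  OneStep-focus []      a q = here q
  OneStep-focus (z ∷ b) a q = there (OneStep-focus b a q)

  OneStep-++ˡ : ∀ {i j} {b b' : Vec A i} (a : Vec A j) → OneStep Q b b' → OneStep Q (b ++ a) (b' ++ a)
  OneStep-++ˡ a (here q)  = here q
  OneStep-++ˡ a (there o) = there (OneStep-++ˡ a o)

  OneStep-++ʳ : ∀ {i j} (b : Vec A i) {a a' : Vec A j} → OneStep Q a a' → OneStep Q (b ++ a) (b ++ a')
  OneStep-++ʳ []      o = o
  OneStep-++ʳ (z ∷ b) o = there (OneStep-++ʳ b o)

  OneStep-map : ∀ {Q' : A → A → Set} → (∀ {x y} → Q x y → Q' x y) →
                ∀ {k} {v v' : Vec A k} → OneStep Q v v' → OneStep Q' v v'
  OneStep-map f (here q)  = here (f q)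
  OneStep-map f (there o) = there (OneStep-map f o)

  data StepInto {i j} (b : Vec A i) (x : A) (a : Vec A j) : Vec A (i + suc j) → Set where
    inPrefix : ∀ {b₀} → OneStep Q b₀ b → StepInto b x a (b₀ ++ x ∷ a)
    atFocus  : ∀ {x₀} → Q x₀ x → StepInto b x a (b ++ x₀ ∷ a)
    inSuffix : ∀ {a₀} → OneStep Q a₀ a → StepInto b x a (b ++ x ∷ a₀)

  stepInto : ∀ {i j} (b : Vec A i) {x : A} {a : Vec A j} {v} → OneStep Q v (b ++ x ∷ a) → StepInto b x a v
  stepInto []      (here q)  = atFocus q
  stepInto []      (there o) = inSuffix o
  stepInto (y ∷ b) (here q)  = inPrefix (here q)
  stepInto (y ∷ b) (there o) with stepInto b o
  ... | inPrefix o' = inPrefix (there o')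
  ... | atFocus q   = atFocus q
  ... | inSuffix o' = inSuffix o'

boxArgs : ∀ {R : TmRel} {n k} {ts ts' : Vec (Tm n) k} {u} → OneStep (Comp R) ts ts' → Comp R (box k ts u) (box k ts' u)
boxArgs o with OneStep⇒Focused o
... | focus {i} {j} _ _ q = boxArg i j q

-- Stability of ⊥-conversion under substitution

renV-++ : ∀ {m m' i j} (ρ : Fin m → Fin m') (b : Vec (Tm m) i) x (a : Vec (Tm m) j) →
          renV ρ (b ++ x ∷ a) ≡ renV ρ b ++ ren ρ x ∷ renV ρ a
renV-++ ρ []      x a = refl
renV-++ ρ (y ∷ b) x a = cong (ren ρ y ∷_) (renV-++ ρ b x a)

subV-++ : ∀ {m m' i j} (σ : Fin m → Tm m') (b : Vec (Tm m) i) x (a : Vec (Tm m) j) →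
          subV σ (b ++ x ∷ a) ≡ subV σ b ++ sub σ x ∷ subV σ a
subV-++ σ []      x a = refl
subV-++ σ (y ∷ b) x a = cong (sub σ y ∷_) (subV-++ σ b x a)

>⊥-ren : ∀ {m m'} (ρ : Fin m → Fin m') {a b : Tm m} → a >⊥ b → ren ρ a >⊥ ren ρ b
>⊥-ren ρ (root (appE t s))     = root (appE _ _)
>⊥-ren ρ (root (pi1E t))       = root (pi1E _)
>⊥-ren ρ (root (pi2E t))       = root (pi2E _)
>⊥-ren ρ (root (CE t t₁ t₂))   = root (CE _ _ _)
>⊥-ren ρ (root (EE t))         = root (EE _)
>⊥-ren ρ (root (BE i j before t after s))
  rewrite renV-++ ρ before (E t) after = root (BE i j _ _ _ _)
>⊥-ren ρ (lamC p)  = lamC (>⊥-ren _ p)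
>⊥-ren ρ (appL p)  = appL (>⊥-ren ρ p)
>⊥-ren ρ (appR p)  = appR (>⊥-ren ρ p)
>⊥-ren ρ (pairL p) = pairL (>⊥-ren ρ p)
>⊥-ren ρ (pairR p) = pairR (>⊥-ren ρ p)
>⊥-ren ρ (pi1C p)  = pi1C (>⊥-ren ρ p)
>⊥-ren ρ (pi2C p)  = pi2C (>⊥-ren ρ p)
>⊥-ren ρ (in1C p)  = in1C (>⊥-ren ρ p)
>⊥-ren ρ (in2C p)  = in2C (>⊥-ren ρ p)
>⊥-ren ρ (caseC p) = caseC (>⊥-ren ρ p)
>⊥-ren ρ (case1 p) = case1 (>⊥-ren _ p)
>⊥-ren ρ (case2 p) = case2 (>⊥-ren _ p)
>⊥-ren ρ (EC p)    = EC (>⊥-ren ρ p)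
>⊥-ren ρ (boxArg i j {before} {t} {t'} {after} p)
  rewrite renV-++ ρ before t after | renV-++ ρ before t' after = boxArg i j (>⊥-ren ρ p)
>⊥-ren ρ (boxBody k p) = boxBody k (>⊥-ren _ p)

>⊥-renV : ∀ {m m' k} (ρ : Fin m → Fin m') {v v' : Vec (Tm m) k} →
          OneStep _>⊥_ v v' → OneStep _>⊥_ (renV ρ v) (renV ρ v')
>⊥-renV ρ (here p)  = here (>⊥-ren ρ p)
>⊥-renV ρ (there o) = there (>⊥-renV ρ o)

>⊥-sub : ∀ {m m'} (σ : Fin m → Tm m') {a b : Tm m} → a >⊥ b → sub σ a >⊥ sub σ b
>⊥-sub σ (root (appE t s))     = root (appE _ _)
>⊥-sub σ (root (pi1E t))       = root (pi1E _)
>⊥-sub σ (root (pi2E t))       = root (pi2E _)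
>⊥-sub σ (root (CE t t₁ t₂))   = root (CE _ _ _)
>⊥-sub σ (root (EE t))         = root (EE _)
>⊥-sub σ (root (BE i j before t after s))
  rewrite subV-++ σ before (E t) after = root (BE i j _ _ _ _)
>⊥-sub σ (lamC p)  = lamC (>⊥-sub _ p)
>⊥-sub σ (appL p)  = appL (>⊥-sub σ p)
>⊥-sub σ (appR p)  = appR (>⊥-sub σ p)
>⊥-sub σ (pairL p) = pairL (>⊥-sub σ p)
>⊥-sub σ (pairR p) = pairR (>⊥-sub σ p)
>⊥-sub σ (pi1C p)  = pi1C (>⊥-sub σ p)
>⊥-sub σ (pi2C p)  = pi2C (>⊥-sub σ p)
>⊥-sub σ (in1C p)  = in1C (>⊥-sub σ p)
>⊥-sub σ (in2C p)  = in2C (>⊥-sub σ p)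
>⊥-sub σ (caseC p) = caseC (>⊥-sub σ p)
>⊥-sub σ (case1 p) = case1 (>⊥-sub _ p)
>⊥-sub σ (case2 p) = case2 (>⊥-sub _ p)
>⊥-sub σ (EC p)    = EC (>⊥-sub σ p)
>⊥-sub σ (boxArg i j {before} {t} {t'} {after} p)
  rewrite subV-++ σ before t after | subV-++ σ before t' after = boxArg i j (>⊥-sub σ p)
>⊥-sub σ (boxBody k p) = boxBody k (>⊥-sub _ p)

_≫⊥ₛ_ : ∀ {m m'} → (Fin m → Tm m') → (Fin m → Tm m') → Set
σ ≫⊥ₛ σ' = ∀ x → σ x ≫⊥ σ' x

Star-cong₂ : ∀ {A B C : Set} {P : A → A → Set} {P' : B → B → Set} {Q : C → C → Set} (f : A → B → C) →
             (∀ {a a' b} → P a a' → Q (f a b) (f a' b)) → (∀ {a b b'} → P' b b' → Q (f a b) (f a b')) →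
             ∀ {a a' b b'} → Star P a a' → Star P' b b' → Star Q (f a b) (f a' b')
Star-cong₂ f left right {_} {a'} {b} ps ps' = gmap (λ z → f z b) left ps ◅◅ gmap (f a') right ps'

liftS-≫⊥ₛ : ∀ {m m'} k {σ σ' : Fin m → Tm m'} → σ ≫⊥ₛ σ' → liftS k σ ≫⊥ₛ liftS k σ'
liftS-≫⊥ₛ k h i with splitAt k i
... | inj₁ _ = ε
... | inj₂ b = gmap (ren (k ↑ʳ_)) (>⊥-ren (k ↑ʳ_)) (h b)

mutual
  sub-≫⊥ₛ : ∀ {m m'} {σ σ' : Fin m → Tm m'} → σ ≫⊥ₛ σ' → ∀ u → sub σ u ≫⊥ sub σ' u
  sub-≫⊥ₛ h (var x)    = h x
  sub-≫⊥ₛ h (lam t)    = gmap lam lamC (sub-≫⊥ₛ (liftS-≫⊥ₛ 1 h) t)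
  sub-≫⊥ₛ h (app t s)  = Star-cong₂ app appL appR (sub-≫⊥ₛ h t) (sub-≫⊥ₛ h s)
  sub-≫⊥ₛ h (pair t s) = Star-cong₂ pair pairL pairR (sub-≫⊥ₛ h t) (sub-≫⊥ₛ h s)
  sub-≫⊥ₛ h (pi1 t)    = gmap pi1 pi1C (sub-≫⊥ₛ h t)
  sub-≫⊥ₛ h (pi2 t)    = gmap pi2 pi2C (sub-≫⊥ₛ h t)
  sub-≫⊥ₛ h (in1 t)    = gmap in1 in1C (sub-≫⊥ₛ h t)
  sub-≫⊥ₛ h (in2 t)    = gmap in2 in2C (sub-≫⊥ₛ h t)
  sub-≫⊥ₛ {σ' = σ'} h (case t t₁ t₂) =
    gmap _ caseC (sub-≫⊥ₛ h t) ◅◅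
    Star-cong₂ (case (sub σ' t)) case1 case2 (sub-≫⊥ₛ h₁ t₁) (sub-≫⊥ₛ h₁ t₂)
    where h₁ = liftS-≫⊥ₛ 1 h
  sub-≫⊥ₛ h (E t)      = gmap E EC (sub-≫⊥ₛ h t)
  sub-≫⊥ₛ h (box k ts u) =
    Star-cong₂ (box k) boxArgs (boxBody k) (subV-≫⊥ₛ h ts) (sub-≫⊥ₛ (liftS-≫⊥ₛ k h) u)

  subV-≫⊥ₛ : ∀ {m m' k} {σ σ' : Fin m → Tm m'} → σ ≫⊥ₛ σ' → (ts : Vec (Tm m) k) →
             Star (OneStep _>⊥_) (subV σ ts) (subV σ' ts)
  subV-≫⊥ₛ h []       = ε
  subV-≫⊥ₛ h (t ∷ ts) = Star-cong₂ _∷_ here there (sub-≫⊥ₛ h t) (subV-≫⊥ₛ h ts)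

[0:=]-≫⊥ : ∀ {m} (u : Tm (suc m)) {a b : Tm m} → a >⊥ b → (u [0:= a ]) ≫⊥ (u [0:= b ])
[0:=]-≫⊥ u {a} {b} p = sub-≫⊥ₛ sub0-≫⊥ₛ u
  where
  sub0-≫⊥ₛ : sub0 a ≫⊥ₛ sub0 b
  sub0-≫⊥ₛ zero    = return p
  sub0-≫⊥ₛ (suc x) = ε

mergeσ-≫⊥ₛ : ∀ {m} i k j {w w' : Tm (k + m)} → w >⊥ w' → mergeσ i k j w ≫⊥ₛ mergeσ i k j w'
mergeσ-≫⊥ₛ i k j p x with splitAt (i + suc j) x
... | inj₂ _ = ε
... | inj₁ a with splitAt i a
...   | inj₁ _       = ε
...   | inj₂ zero    = return (>⊥-ren (renInner i k j) p)
...   | inj₂ (suc _) = ε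

-- Postponement

RootStep : RKind → TmRel
RootStep D = DetourR
RootStep P = PermR

Postponed : RKind → ∀ {n} → Tm n → Tm n → Set
Postponed R r t = ∃ λ k → TransClosure (Comp (RootStep R)) r k × k ≫⊥ t

Postponable : RKind → ∀ {n} → Tm n → Tm n → Set
Postponable R a a' = ∀ {t} → Comp (RootStep R) a' t → Postponed R a t

>⊥-Postponable : RKind → ∀ {n} → Tm n → Tm n → Set
>⊥-Postponable R a a' = a >⊥ a' × Postponable R a a'

postponed : ∀ {R n} {r k t : Tm n} → Comp (RootStep R) r k → k ≫⊥ t → Postponed R r t
postponed q ps = _ , [ q ] , ps

TransClosure-gmap : ∀ {Q : TmRel} {n m} (f : Tm n → Tm m) → (∀ {x y} → Comp Q x y → Comp Q (f x) (f y)) →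
                    ∀ {x y} → TransClosure (Comp Q) x y → TransClosure (Comp Q) (f x) (f y)
TransClosure-gmap f g [ q ]    = [ g q ]
TransClosure-gmap f g (q ∷ qs) = g q ∷ TransClosure-gmap f g qs

Postponed-cong : ∀ R {n m} (f : Tm n → Tm m) → (∀ {Q : TmRel} {x y} → Comp Q x y → Comp Q (f x) (f y)) →
                 ∀ {x z} → Postponed R x z → Postponed R (f x) (f z)
Postponed-cong R f g (k , qs , ps) = f k , TransClosure-gmap f g qs , gmap f g ps

var-irreducible : ∀ {n} {u : Tm n} {x} → u >⊥ var x → ⊥
var-irreducible (root ())

postpone-root : ∀ R {n} {r s t : Tm n} → BotR r s → Comp (RootStep R) s t → Postponed R r t
postpone-root R (appE a b) (EC q) = postponed (appL (EC q)) (return (root (appE _ _)))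
postpone-root D (appE a b) (root ())
postpone-root P (appE a b) (root (EC c t₁ t₂)) =
  _ , appL (root (EC c t₁ t₂)) ∷ [ root (appC c (E t₁) (E t₂) b) ] ,
  case1 (root (appE _ _)) ◅ case2 (root (appE _ _)) ◅ ε
postpone-root R (pi1E a) (EC q) = postponed (pi1C (EC q)) (return (root (pi1E _)))
postpone-root D (pi1E a) (root ())
postpone-root P (pi1E a) (root (EC c t₁ t₂)) =
  _ , pi1C (root (EC c t₁ t₂)) ∷ [ root (pi1C c (E t₁) (E t₂)) ] ,
  case1 (root (pi1E _)) ◅ case2 (root (pi1E _)) ◅ ε
postpone-root R (pi2E a) (EC q) = postponed (pi2C (EC q)) (return (root (pi2E _)))
postpone-root D (pi2E a) (root ())
postpone-root P (pi2E a) (root (EC c t₁ t₂)) =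
  _ , pi2C (root (EC c t₁ t₂)) ∷ [ root (pi2C c (E t₁) (E t₂)) ] ,
  case1 (root (pi2E _)) ◅ case2 (root (pi2E _)) ◅ ε
postpone-root R (CE a s₁ s₂) (EC q) = postponed (caseC (EC q)) (return (root (CE _ _ _)))
postpone-root D (CE a s₁ s₂) (root ())
postpone-root P (CE a s₁ s₂) (root (EC c t₁ t₂)) =
  _ , caseC (root (EC c t₁ t₂)) ∷ [ root (CC c (E t₁) (E t₂) s₁ s₂) ] ,
  case1 (root (CE _ _ _)) ◅ case2 (root (CE _ _ _)) ◅ ε
postpone-root R (EE a) (EC q) = postponed (EC (EC q)) (return (root (EE _)))
postpone-root D (EE a) (root ())
postpone-root P (EE a) (root (EC c t₁ t₂)) =
  _ , EC (root (EC c t₁ t₂)) ∷ [ root (EC c (E t₁) (E t₂)) ] ,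
  case1 (root (EE _)) ◅ case2 (root (EE _)) ◅ ε
postpone-root R (BE i j before a after s) (EC q) =
  postponed (boxArg i j (EC q)) (return (root (BE i j _ _ _ _)))
postpone-root D (BE i j before a after s) (root ())
postpone-root P (BE i j before a after s) (root (EC c t₁ t₂)) =
  _ , boxArg i j (root (EC c t₁ t₂)) ∷ [ root (BC i j before c (E t₁) (E t₂) after s) ] ,
  case1 (root (BE i j _ _ _ _)) ◅ case2 (root (BE i j _ _ _ _)) ◅ ε

postpone-lam : ∀ R {n} {a a' : Tm (suc n)} {t} → a >⊥ a' → Postponable R a a' →
               Comp (RootStep R) (lam a') t → Postponed R (lam a) t
postpone-lam D p ih (root ())
postpone-lam P p ih (root ())
postpone-lam R p ih (lamC q) = Postponed-cong R lam lamC (ih q)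

postpone-appL : ∀ R {n} {a a' b t : Tm n} → a >⊥ a' → Postponable R a a' →
                Comp (RootStep R) (app a' b) t → Postponed R (app a b) t
postpone-appL D (lamC p) ih (root (β w b))           = postponed (root (β _ b)) (return (>⊥-sub (sub0 b) p))
postpone-appL D (root ()) ih (root (β w b))
postpone-appL P (caseC p) ih (root (appC c t₁ t₂ b)) = postponed (root (appC _ t₁ t₂ b)) (return (caseC p))
postpone-appL P (case1 p) ih (root (appC c t₁ t₂ b)) = postponed (root (appC c _ t₂ b)) (return (case1 (appL p)))
postpone-appL P (case2 p) ih (root (appC c t₁ t₂ b)) = postponed (root (appC c t₁ _ b)) (return (case2 (appL p)))
postpone-appL P (root ()) ih (root (appC c t₁ t₂ b))
postpone-appL R p ih (appL q) = Postponed-cong R (λ z → app z _) appL (ih q)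
postpone-appL R p ih (appR q) = postponed (appR q) (return (appL p))

postpone-appR : ∀ R {n} {a b b' t : Tm n} → b >⊥ b' → Postponable R b b' →
                Comp (RootStep R) (app a b') t → Postponed R (app a b) t
postpone-appR D p ih (root (β w b')) = postponed (root (β w _)) ([0:=]-≫⊥ w p)
postpone-appR P p ih (root (appC c t₁ t₂ b')) =
  postponed (root (appC c t₁ t₂ _)) (case1 (appR (>⊥-ren suc p)) ◅ case2 (appR (>⊥-ren suc p)) ◅ ε)
postpone-appR R p ih (appL q) = postponed (appL q) (return (appR p))
postpone-appR R p ih (appR q) = Postponed-cong R (app _) appR (ih q)

postpone-pairL : ∀ R {n} {a a' b t : Tm n} → a >⊥ a' → Postponable R a a' →
                 Comp (RootStep R) (pair a' b) t → Postponed R (pair a b) t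
postpone-pairL D p ih (root ())
postpone-pairL P p ih (root ())
postpone-pairL R p ih (pairL q) = Postponed-cong R (λ z → pair z _) pairL (ih q)
postpone-pairL R p ih (pairR q) = postponed (pairR q) (return (pairL p))

postpone-pairR : ∀ R {n} {a b b' t : Tm n} → b >⊥ b' → Postponable R b b' →
                 Comp (RootStep R) (pair a b') t → Postponed R (pair a b) t
postpone-pairR D p ih (root ())
postpone-pairR P p ih (root ())
postpone-pairR R p ih (pairL q) = postponed (pairL q) (return (pairR p))
postpone-pairR R p ih (pairR q) = Postponed-cong R (pair _) pairR (ih q)

postpone-pi1 : ∀ R {n} {a a' t : Tm n} → a >⊥ a' → Postponable R a a' →
               Comp (RootStep R) (pi1 a') t → Postponed R (pi1 a) t
postpone-pi1 D (pairL p) ih (root (π₁β t₁ t₂))  = postponed (root (π₁β _ _)) (return p)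
postpone-pi1 D (pairR p) ih (root (π₁β t₁ t₂))  = postponed (root (π₁β _ _)) ε
postpone-pi1 D (root ()) ih (root (π₁β t₁ t₂))
postpone-pi1 P (caseC p) ih (root (pi1C c t₁ t₂)) = postponed (root (pi1C _ _ _)) (return (caseC p))
postpone-pi1 P (case1 p) ih (root (pi1C c t₁ t₂)) = postponed (root (pi1C _ _ _)) (return (case1 (pi1C p)))
postpone-pi1 P (case2 p) ih (root (pi1C c t₁ t₂)) = postponed (root (pi1C _ _ _)) (return (case2 (pi1C p)))
postpone-pi1 P (root ()) ih (root (pi1C c t₁ t₂))
postpone-pi1 R p ih (pi1C q) = Postponed-cong R pi1 pi1C (ih q)

postpone-pi2 : ∀ R {n} {a a' t : Tm n} → a >⊥ a' → Postponable R a a' →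
               Comp (RootStep R) (pi2 a') t → Postponed R (pi2 a) t
postpone-pi2 D (pairL p) ih (root (π₂β t₁ t₂))  = postponed (root (π₂β _ _)) ε
postpone-pi2 D (pairR p) ih (root (π₂β t₁ t₂))  = postponed (root (π₂β _ _)) (return p)
postpone-pi2 D (root ()) ih (root (π₂β t₁ t₂))
postpone-pi2 P (caseC p) ih (root (pi2C c t₁ t₂)) = postponed (root (pi2C _ _ _)) (return (caseC p))
postpone-pi2 P (case1 p) ih (root (pi2C c t₁ t₂)) = postponed (root (pi2C _ _ _)) (return (case1 (pi2C p)))
postpone-pi2 P (case2 p) ih (root (pi2C c t₁ t₂)) = postponed (root (pi2C _ _ _)) (return (case2 (pi2C p)))
postpone-pi2 P (root ()) ih (root (pi2C c t₁ t₂))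
postpone-pi2 R p ih (pi2C q) = Postponed-cong R pi2 pi2C (ih q)

postpone-in1 : ∀ R {n} {a a' t : Tm n} → a >⊥ a' → Postponable R a a' →
               Comp (RootStep R) (in1 a') t → Postponed R (in1 a) t
postpone-in1 D p ih (root ())
postpone-in1 P p ih (root ())
postpone-in1 R p ih (in1C q) = Postponed-cong R in1 in1C (ih q)

postpone-in2 : ∀ R {n} {a a' t : Tm n} → a >⊥ a' → Postponable R a a' →
               Comp (RootStep R) (in2 a') t → Postponed R (in2 a) t
postpone-in2 D p ih (root ())
postpone-in2 P p ih (root ())
postpone-in2 R p ih (in2C q) = Postponed-cong R in2 in2C (ih q)

postpone-caseC : ∀ R {n} {c c' : Tm n} {t₁ t₂ t} → c >⊥ c' → Postponable R c c' →
                 Comp (RootStep R) (case c' t₁ t₂) t → Postponed R (case c t₁ t₂) t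
postpone-caseC D (in1C p) ih (root (C₁β a t₁ t₂)) = postponed (root (C₁β _ _ _)) ([0:=]-≫⊥ t₁ p)
postpone-caseC D (root ()) ih (root (C₁β a t₁ t₂))
postpone-caseC D (in2C p) ih (root (C₂β a t₁ t₂)) = postponed (root (C₂β _ _ _)) ([0:=]-≫⊥ t₂ p)
postpone-caseC D (root ()) ih (root (C₂β a t₁ t₂))
postpone-caseC P (caseC p) ih (root (CC d u₁ u₂ s₁ s₂)) = postponed (root (CC _ _ _ _ _)) (return (caseC p))
postpone-caseC P (case1 p) ih (root (CC d u₁ u₂ s₁ s₂)) = postponed (root (CC _ _ _ _ _)) (return (case1 (caseC p)))
postpone-caseC P (case2 p) ih (root (CC d u₁ u₂ s₁ s₂)) = postponed (root (CC _ _ _ _ _)) (return (case2 (caseC p)))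
postpone-caseC P (root ()) ih (root (CC d u₁ u₂ s₁ s₂))
postpone-caseC R p ih (caseC q) = Postponed-cong R (λ z → case z _ _) caseC (ih q)
postpone-caseC R p ih (case1 q) = postponed (case1 q) (return (caseC p))
postpone-caseC R p ih (case2 q) = postponed (case2 q) (return (caseC p))

postpone-case1 : ∀ R {n} {c : Tm n} {t₁ t₁' t₂ t} → t₁ >⊥ t₁' → Postponable R t₁ t₁' →
                 Comp (RootStep R) (case c t₁' t₂) t → Postponed R (case c t₁ t₂) t
postpone-case1 D p ih (root (C₁β a t₁ t₂)) = postponed (root (C₁β _ _ _)) (return (>⊥-sub (sub0 a) p))
postpone-case1 D p ih (root (C₂β a t₁ t₂)) = postponed (root (C₂β _ _ _)) ε
postpone-case1 P p ih (root (CC d u₁ u₂ s₁ s₂)) =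
  postponed (root (CC _ _ _ _ _)) (case1 (case1 (>⊥-ren _ p)) ◅ case2 (case1 (>⊥-ren _ p)) ◅ ε)
postpone-case1 R p ih (caseC q) = postponed (caseC q) (return (case1 p))
postpone-case1 R p ih (case1 q) = Postponed-cong R (λ z → case _ z _) case1 (ih q)
postpone-case1 R p ih (case2 q) = postponed (case2 q) (return (case1 p))

postpone-case2 : ∀ R {n} {c : Tm n} {t₁ t₂ t₂' t} → t₂ >⊥ t₂' → Postponable R t₂ t₂' →
                 Comp (RootStep R) (case c t₁ t₂') t → Postponed R (case c t₁ t₂) t
postpone-case2 D p ih (root (C₁β a t₁ t₂)) = postponed (root (C₁β _ _ _)) ε
postpone-case2 D p ih (root (C₂β a t₁ t₂)) = postponed (root (C₂β _ _ _)) (return (>⊥-sub (sub0 a) p))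
postpone-case2 P p ih (root (CC d u₁ u₂ s₁ s₂)) =
  postponed (root (CC _ _ _ _ _)) (case1 (case2 (>⊥-ren _ p)) ◅ case2 (case2 (>⊥-ren _ p)) ◅ ε)
postpone-case2 R p ih (caseC q) = postponed (caseC q) (return (case2 p))
postpone-case2 R p ih (case1 q) = postponed (case1 q) (return (case2 p))
postpone-case2 R p ih (case2 q) = Postponed-cong R (λ z → case _ _ z) case2 (ih q)

postpone-E : ∀ R {n} {a a' t : Tm n} → a >⊥ a' → Postponable R a a' →
             Comp (RootStep R) (E a') t → Postponed R (E a) t
postpone-E D p ih (root ())
postpone-E P (caseC p) ih (root (EC c t₁ t₂)) = postponed (root (EC _ _ _)) (return (caseC p))
postpone-E P (case1 p) ih (root (EC c t₁ t₂)) = postponed (root (EC _ _ _)) (return (case1 (EC p)))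
postpone-E P (case2 p) ih (root (EC c t₁ t₂)) = postponed (root (EC _ _ _)) (return (case2 (EC p)))
postpone-E P (root ()) ih (root (EC c t₁ t₂))
postpone-E R p ih (EC q) = Postponed-cong R E EC (ih q)

postpone-boxBody : ∀ R {n k} {ts : Vec (Tm n) k} {u u' t} → u >⊥ u' → Postponable R u u' →
                   Comp (RootStep R) (box k ts u') t → Postponed R (box k ts u) t
postpone-boxBody D p ih (root (Bβ i m j before ss w after r)) =
  postponed (root (Bβ i m j before ss w after _)) (return (boxBody _ (>⊥-sub _ p)))
postpone-boxBody D p ih (root (Bη _)) with var-irreducible p
... | ()
postpone-boxBody P p ih (root (BC i j before c s₁ s₂ after s)) =
  postponed (root (BC i j before c s₁ s₂ after _))
            (case1 (boxBody _ (>⊥-ren _ p)) ◅ case2 (boxBody _ (>⊥-ren _ p)) ◅ ε)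
postpone-boxBody R p ih (boxArg i j q)  = postponed (boxArg i j q) (return (boxBody _ p))
postpone-boxBody R p ih (boxBody k q)   = Postponed-cong R (box k _) (boxBody k) (ih q)

postpone-Bβ-inner : ∀ {n} i j m (before : Vec (Tm n) i) (ss : Vec (Tm n) m) w (after : Vec (Tm n) j)
                      (r : Tm ((i + suc j) + n)) {x₀} → x₀ >⊥ box m ss w →
                    Postponed D (box (i + suc j) (before ++ x₀ ∷ after) r)
                                (box (i + (m + j)) (before ++ ss ++ after) (sub (mergeσ i m j w) r))
postpone-Bβ-inner i j m before ss w after r (root ())
postpone-Bβ-inner i j m before ss w after r (boxArg _ _ {before = b'} {after = a'} p) =
  postponed (root (Bβ i m j before _ w after r))
            (return (boxArgs (OneStep-++ʳ before (OneStep-++ˡ after (OneStep-focus b' a' p)))))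
postpone-Bβ-inner i j m before ss w after r (boxBody m p) =
  postponed (root (Bβ i m j before ss _ after r))
            (gmap (box _ _) (boxBody _) (sub-≫⊥ₛ (mergeσ-≫⊥ₛ i m j p) r))

postpone-BC-inner : ∀ {n} i j (before : Vec (Tm n) i) c s₁ s₂ (after : Vec (Tm n) j)
                      (s : Tm ((i + suc j) + n)) {x₀} →
                    x₀ >⊥ case c s₁ s₂ →
                    Postponed P (box (i + suc j) (before ++ x₀ ∷ after) s)
                      (case c (box (i + suc j) (wkV before ++ s₁ ∷ wkV after) (ren (liftR (i + suc j) suc) s))
                              (box (i + suc j) (wkV before ++ s₂ ∷ wkV after) (ren (liftR (i + suc j) suc) s)))
postpone-BC-inner i j before c s₁ s₂ after s (root ())
postpone-BC-inner i j before c s₁ s₂ after s (caseC p) =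
  postponed (root (BC i j before _ s₁ s₂ after s)) (return (caseC p))
postpone-BC-inner i j before c s₁ s₂ after s (case1 p) =
  postponed (root (BC i j before c _ s₂ after s)) (return (case1 (boxArg i j p)))
postpone-BC-inner i j before c s₁ s₂ after s (case2 p) =
  postponed (root (BC i j before c s₁ _ after s)) (return (case2 (boxArg i j p)))

postpone-Bη : ∀ {n} {ts₀ : Vec (Tm n) 1} {t} → OneStep (>⊥-Postponable D) ts₀ (t ∷ []) →
              Postponed D (box 1 ts₀ (var zero)) t
postpone-Bη (here (p , _)) = postponed (root (Bη _)) (return p)

postpone-boxArgs : ∀ R {n k} {ts₀ ts : Vec (Tm n) k} {u t} → OneStep (>⊥-Postponable R) ts₀ ts →
                   Comp (RootStep R) (box k ts u) t → Postponed R (box k ts₀ u) t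
postpone-boxArgs R o (boxBody k q) = postponed (boxBody k q) (return (boxArgs (OneStep-map proj₁ o)))
postpone-boxArgs R o (boxArg i j {before} {_} {y'} {after} q) with stepInto before o
... | inPrefix o'      = postponed (boxArg i j q)
                                  (return (boxArgs (OneStep-++ˡ (y' ∷ after) (OneStep-map proj₁ o'))))
... | atFocus (_ , ih) = Postponed-cong R (λ z → box _ (before ++ z ∷ after) _) (boxArg i j) (ih q)
... | inSuffix o'      = postponed (boxArg i j q)
                                  (return (boxArgs (OneStep-++ʳ before (there (OneStep-map proj₁ o')))))
postpone-boxArgs D o (root (Bη _)) = postpone-Bη o
postpone-boxArgs D o (root (Bβ i m j before ss w after r)) with stepInto before o
... | inPrefix o'    = postponed (root (Bβ i m j _ ss w after r))
                                 (return (boxArgs (OneStep-++ˡ (ss ++ after) (OneStep-map proj₁ o'))))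
... | atFocus (p , _) = postpone-Bβ-inner i j m before ss w after r p
... | inSuffix o'    = postponed (root (Bβ i m j before ss w _ r))
                                 (return (boxArgs (OneStep-++ʳ before (OneStep-++ʳ ss (OneStep-map proj₁ o')))))
postpone-boxArgs P o (root (BC i j before c s₁ s₂ after s)) with stepInto before o
... | inPrefix o' = postponed (root (BC i j _ c s₁ s₂ after s))
                      (case1 (boxArgs (OneStep-++ˡ (s₁ ∷ wkV after) o'')) ◅
                       case2 (boxArgs (OneStep-++ˡ (s₂ ∷ wkV after) o'')) ◅ ε)
  where o'' = >⊥-renV suc (OneStep-map proj₁ o')
... | atFocus (p , _) = postpone-BC-inner i j before c s₁ s₂ after s p
... | inSuffix o' = postponed (root (BC i j before c s₁ s₂ _ s))
                      (case1 (boxArgs (OneStep-++ʳ (wkV before) (there o''))) ◅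
                       case2 (boxArgs (OneStep-++ʳ (wkV before) (there o''))) ◅ ε)
  where o'' = >⊥-renV suc (OneStep-map proj₁ o')

postpone : ∀ R {n} {r s t : Tm n} → r >⊥ s → Comp (RootStep R) s t → Postponed R r t
postpone R (root p)  = postpone-root R p
postpone R (lamC p)  = postpone-lam R p (postpone R p)
postpone R (appL p)  = postpone-appL R p (postpone R p)
postpone R (appR p)  = postpone-appR R p (postpone R p)
postpone R (pairL p) = postpone-pairL R p (postpone R p)
postpone R (pairR p) = postpone-pairR R p (postpone R p)
postpone R (pi1C p)  = postpone-pi1 R p (postpone R p)
postpone R (pi2C p)  = postpone-pi2 R p (postpone R p)
postpone R (in1C p)  = postpone-in1 R p (postpone R p)
postpone R (in2C p)  = postpone-in2 R p (postpone R p)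
postpone R (caseC p) = postpone-caseC R p (postpone R p)
postpone R (case1 p) = postpone-case1 R p (postpone R p)
postpone R (case2 p) = postpone-case2 R p (postpone R p)
postpone R (EC p)    = postpone-E R p (postpone R p)
postpone R (boxArg i j {before} {after = after} p) =
  postpone-boxArgs R (OneStep-focus before after (p , postpone R p))
postpone R (boxBody k p) = postpone-boxBody R p (postpone R p)

lemma25 : ∀ (R : RKind) {n : ℕ} (r s t : Tm n) →
    r >⊥ s → red R s t → ∃ λ k → (r >⁺[ R ] k) × (k ≫⊥ t)
lemma25 D r s t = postpone D
lemma25 P r s t = postpone P
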